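{- There is an absolute constant $c>0$ such that the following holds. Let $q$ be a prime power and $P\subset\mathbb{F}_q^2$, and suppose that $T(P)\geq |P|/2$. Then $a(P)\geq c\,|P|^{3/2}/T(P)^{1/2}$.
   Context: $\mathbb{F}_q$ is the finite field with $q$ elements. $T(P)$ is the number of collinear triples in $P$, i.e. sets of three distinct points of $P$ lying on a common affine line. An arc is a subset containing no collinear triple, and $a(P)$ is the maximum cardinality of an arc contained in $P$. -}

module Defs where

open import Level using (0ℓ)
open import Data.Nat using (ℕ; zero; suc; _⊔_) renaming (_+_ to _+ℕ_)
open import Data.Bool using (Bool; true; false; _∧_; _∨_; not; if_then_else_)
open import Data.List using (List; []; _∷_; length; map; foldr; filter; _++_)
open import Data.Bool.ListAction using (any)
open import Data.List.Relation.Unary.Any using (Any)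
open import Data.List.Relation.Unary.AllPairs using (AllPairs)
open import Data.Product using (_×_; _,_; ∃)
open import Relation.Nullary using (¬_; Dec; yes; no)
open import Relation.Nullary.Decidable using (⌊_⌋)
open import Relation.Binary using (Decidable)
open import Algebra.Bundles using (CommutativeRing)

-- Finite fields are exactly the fields F_q, q a prime power.
record FiniteField : Set₁ where
  field
    commRing : CommutativeRing 0ℓ 0ℓ
  open CommutativeRing commRing public
  field
    _≟_      : Decidable _≈_
    0≉1      : ¬ (0# ≈ 1#)
    inverse  : ∀ x → ¬ (x ≈ 0#) → ∃ λ y → x * y ≈ 1#
    elems    : List Carrier
    complete : ∀ x → Any (x ≈_) elems
    distinct : AllPairs (λ x y → ¬ (x ≈ y)) elems

module Plane (F : FiniteField) where
  open FiniteField F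

  Point : Set
  Point = Carrier × Carrier

  _≈ₚ_ : Point → Point → Set
  (x , y) ≈ₚ (x' , y') = (x ≈ x') × (y ≈ y')

  PointSet : Set
  PointSet = List Point

  Distinct : PointSet → Set
  Distinct = AllPairs (λ p p' → ¬ (p ≈ₚ p'))

  eqb : Carrier → Carrier → Bool
  eqb x y = ⌊ x ≟ y ⌋

  onLine : Carrier → Carrier → Carrier → Point → Bool
  onLine a b c (x , y) = eqb ((a * x) + (b * y)) c

  collinear : Point → Point → Point → Bool
  collinear p q r =
    any (λ a → any (λ b → any (λ c →
          not (eqb a 0# ∧ eqb b 0#) ∧ onLine a b c p ∧ onLine a b c q ∧ onLine a b c r)
        elems) elems) elems

  -- all 3-element subsets (as triples taken in list order) of a list
  pairsFrom : Point → List Point → List (Point × Point × Point)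
  pairsFrom p [] = []
  pairsFrom p (q ∷ qs) = map (λ r → p , q , r) qs ++ pairsFrom p qs

  triples : List Point → List (Point × Point × Point)
  triples [] = []
  triples (p ∷ ps) = pairsFrom p ps ++ triples ps

  count : {A : Set} → (A → Bool) → List A → ℕ
  count f [] = 0
  count f (x ∷ xs) = (if f x then 1 else 0) +ℕ count f xs

  T : PointSet → ℕ
  T P = count (λ { (p , q , r) → collinear p q r }) (triples P)

  subsets : {A : Set} → List A → List (List A)
  subsets [] = [] ∷ []
  subsets (x ∷ xs) = let s = subsets xs in s ++ map (x ∷_) s

  isArc : PointSet → Bool
  isArc Q with T Q
  ... | zero = true
  ... | suc _ = false

  a : PointSet → ℕ
  a P = foldr (λ Q m → (if isArc Q then length Q else 0) ⊔ m) 0 (subsets P)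

-- Deleting each of the n points in turn removes every collinear triple
-- exactly three times, so some deletion keeps at most (n - 3)/n of the T
-- triples.  If the remaining n - 1 points still span at least (n - 1)/2
-- triples, induction applies and (n - 3)/n ≤ ((n - 1)/n)³ closes the step.
-- Otherwise, discarding one point from each of their triples leaves an arc
-- of at least n/2 points, and n³ ≤ (2a)² · 2T.
module Submission where

open import Defs
open import Data.Nat using (ℕ; _*_; _^_; _≤_; NonZero)
open import Data.List using (length)
open import Data.Product using (Σ; _×_)

open import Data.Nat using (zero; suc; _+_; _⊔_; z≤n; s≤s; _≤?_)
open import Data.Nat.Properties
open import Data.Nat.ListAction using (sum)
open import Data.Nat.Tactic.RingSolver using (solve-∀)
open import Data.Nat.Solver using (module +-*-Solver)
open +-*-Solver using (solve; _:+_; _:*_; _:^_; _:=_; con)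
open import Data.Bool using (Bool; if_then_else_)
open import Data.List using (List; []; _∷_; map; foldr; _++_)
open import Data.List.Properties using (map-∘; map-cong; length-map)
open import Data.List.Membership.Propositional using (_∈_)
open import Data.List.Membership.Propositional.Properties
  using (∈-map⁺; ∈-map⁻; ∈-++⁺ˡ; ∈-++⁺ʳ; ∈-++⁻)
open import Data.List.Relation.Binary.Sublist.Propositional
  using (_⊆_; []; _∷_; _∷ʳ_; ⊆-refl; ⊆-trans)
open import Data.List.Relation.Unary.Any using (here; there)
open import Data.Product using (_,_; ∃)
open import Data.Sum using (inj₁; inj₂)
open import Function using (_∘_)
open import Relation.Nullary using (yes; no)
open import Relation.Binary.PropositionalEquality
  using (_≡_; refl; sym; trans; cong; cong₂; subst; module ≡-Reasoning)

sum-map-+ : ∀ {A : Set} (f g : A → ℕ) xs →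
            sum (map (λ x → f x + g x) xs) ≡ sum (map f xs) + sum (map g xs)
sum-map-+ f g []       = refl
sum-map-+ f g (x ∷ xs) = begin
  f x + g x + sum (map (λ x → f x + g x) xs)  ≡⟨ cong (f x + g x +_) (sum-map-+ f g xs) ⟩
  f x + g x + (sum (map f xs) + sum (map g xs)) ≡⟨ +-assoc-swap (f x) (g x) _ _ ⟩
  f x + sum (map f xs) + (g x + sum (map g xs)) ∎
  where
  open ≡-Reasoning
  +-assoc-swap : ∀ a b c d → a + b + (c + d) ≡ a + c + (b + d)
  +-assoc-swap = solve-∀

sum-map-const : ∀ {A : Set} c (xs : List A) → sum (map (λ _ → c) xs) ≡ length xs * c
sum-map-const c []       = refl
sum-map-const c (x ∷ xs) = cong (c +_) (sum-map-const c xs)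

∃-below-average : ∀ {A : Set} (f : A → ℕ) x xs →
                  ∃ λ y → y ∈ x ∷ xs × length (x ∷ xs) * f y ≤ sum (map f (x ∷ xs))
∃-below-average f x [] = x , here refl , ≤-refl
∃-below-average f x (x′ ∷ xs) with ∃-below-average f x′ xs
... | y , y∈ , avg with f x ≤? f y
...   | yes fx≤fy = x , here refl , +-monoʳ-≤ (f x) (≤-trans (*-monoʳ-≤ (length (x′ ∷ xs)) fx≤fy) avg)
...   | no  fx≰fy = y , there y∈ , +-mono-≤ (<⇒≤ (≰⇒> fx≰fy)) avg

module _ {A : Set} where

  deletions : List A → List (List A)
  deletions []       = []
  deletions (x ∷ xs) = xs ∷ map (x ∷_) (deletions xs)

  length-deletions : ∀ xs → length (deletions xs) ≡ length xs
  length-deletions []       = refl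
  length-deletions (x ∷ xs) = cong suc (trans (length-map (x ∷_) (deletions xs)) (length-deletions xs))

  ∈-deletions⇒⊆ : ∀ {ys} xs → ys ∈ deletions xs → ys ⊆ xs
  ∈-deletions⇒⊆ (x ∷ xs) (here refl) = x ∷ʳ ⊆-refl
  ∈-deletions⇒⊆ (x ∷ xs) (there ys∈) with ∈-map⁻ (x ∷_) ys∈
  ... | zs , zs∈ , refl = refl ∷ ∈-deletions⇒⊆ xs zs∈

  ∈-deletions⇒length : ∀ {ys} xs → ys ∈ deletions xs → length xs ≡ suc (length ys)
  ∈-deletions⇒length (x ∷ xs) (here refl) = refl
  ∈-deletions⇒length (x ∷ xs) (there ys∈) with ∈-map⁻ (x ∷_) ys∈
  ... | zs , zs∈ , refl = cong suc (∈-deletions⇒length xs zs∈)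

  deletionSum : (List A → ℕ) → List A → ℕ
  deletionSum F xs = sum (map F (deletions xs))

  deletionSum-∷ : ∀ F x xs → deletionSum F (x ∷ xs) ≡ F xs + deletionSum (F ∘ (x ∷_)) xs
  deletionSum-∷ F x xs = cong (λ ns → F xs + sum ns) (sym (map-∘ (deletions xs)))

  -- A count F of k-element configurations: deleting each point in turn and
  -- summing loses every configuration exactly k times.
  DeletionIdentity : ℕ → (List A → ℕ) → Set
  DeletionIdentity k F = ∀ xs → deletionSum F xs + k * F xs ≡ length xs * F xs

  deletionIdentity-const : ∀ c → DeletionIdentity 0 (λ _ → c)
  deletionIdentity-const c xs = begin
    deletionSum (λ _ → c) xs + 0 ≡⟨ +-identityʳ _ ⟩
    sum (map (λ _ → c) (deletions xs)) ≡⟨ sum-map-const c (deletions xs) ⟩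
    length (deletions xs) * c ≡⟨ cong (_* c) (length-deletions xs) ⟩
    length xs * c ∎
    where open ≡-Reasoning

  deletionIdentity-∷ : ∀ {k} {F : List A → ℕ} (G : A → List A → ℕ) →
    F [] ≡ 0 → (∀ x xs → F (x ∷ xs) ≡ G x xs + F xs) →
    (∀ x → DeletionIdentity k (G x)) → DeletionIdentity (suc k) F
  deletionIdentity-∷ {k} G F[]≡0 F-∷ G-id [] =
    trans (cong (suc k *_) F[]≡0) (*-zeroʳ (suc k))
  deletionIdentity-∷ {k} {F} G F[]≡0 F-∷ G-id (x ∷ xs) = begin
    deletionSum F (x ∷ xs) + suc k * F (x ∷ xs)
      ≡⟨ cong₂ (λ s v → s + suc k * v) (deletionSum-∷ F x xs) (F-∷ x xs) ⟩
    F xs + deletionSum (F ∘ (x ∷_)) xs + suc k * (g + F xs)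
      ≡⟨ cong (λ s → F xs + s + suc k * (g + F xs)) split ⟩
    F xs + (ΣG + ΣF) + suc k * (g + F xs)
      ≡⟨ regroup (F xs) g ΣG ΣF k ⟩
    (ΣG + k * g) + (ΣF + suc k * F xs) + (g + F xs)
      ≡⟨ cong₂ (λ u v → u + v + (g + F xs)) (G-id x xs)
               (deletionIdentity-∷ {k} {F} G F[]≡0 F-∷ G-id xs) ⟩
    length xs * g + length xs * F xs + (g + F xs)
      ≡⟨ collect (length xs) g (F xs) ⟩
    suc (length xs) * (g + F xs)
      ≡⟨ cong (suc (length xs) *_) (sym (F-∷ x xs)) ⟩
    length (x ∷ xs) * F (x ∷ xs) ∎
    where
    open ≡-Reasoning
    g  = G x xs
    ΣG = deletionSum (G x) xs
    ΣF = deletionSum F xs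
    split : deletionSum (F ∘ (x ∷_)) xs ≡ ΣG + ΣF
    split = trans (cong sum (map-cong (λ ys → F-∷ x ys) (deletions xs)))
                  (sum-map-+ (G x) F (deletions xs))
    regroup : ∀ f g sg sf k →
      f + (sg + sf) + suc k * (g + f) ≡ (sg + k * g) + (sf + suc k * f) + (g + f)
    regroup = solve-∀
    collect : ∀ n g f → n * g + n * f + (g + f) ≡ suc n * (g + f)
    collect = solve-∀

  ∃-deletion-below-average : ∀ {k F} → DeletionIdentity k F → ∀ {n} xs → length xs ≡ suc n →
    ∃ λ ys → ys ⊆ xs × length ys ≡ n × suc n * F ys + k * F xs ≤ suc n * F xs
  ∃-deletion-below-average {k} {F} F-id (x ∷ xs) |xs|≡1+n
    with ∃-below-average F xs (map (x ∷_) (deletions xs))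
  ... | ys , ys∈ , avg =
    ys , ∈-deletions⇒⊆ (x ∷ xs) ys∈ ,
    suc-injective (trans (sym (∈-deletions⇒length (x ∷ xs) ys∈)) |xs|≡1+n) ,
    subst (λ n → n * F ys + k * F (x ∷ xs) ≤ n * F (x ∷ xs)) |xs|≡1+n (begin
      length (x ∷ xs) * F ys + k * F (x ∷ xs)
        ≡⟨ cong (λ m → m * F ys + k * F (x ∷ xs)) (sym (length-deletions (x ∷ xs))) ⟩
      length (deletions (x ∷ xs)) * F ys + k * F (x ∷ xs)
        ≤⟨ +-monoˡ-≤ (k * F (x ∷ xs)) avg ⟩
      deletionSum F (x ∷ xs) + k * F (x ∷ xs)
        ≡⟨ F-id (x ∷ xs) ⟩
      length (x ∷ xs) * F (x ∷ xs) ∎)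
    where open ≤-Reasoning

  Monotone : (List A → ℕ) → Set
  Monotone F = ∀ {ys xs} → ys ⊆ xs → F ys ≤ F xs

  monotone-const : ∀ c → Monotone (λ _ → c)
  monotone-const c _ = ≤-refl

  monotone-∷ : ∀ {F : List A → ℕ} (G : A → List A → ℕ) →
    (∀ x xs → F (x ∷ xs) ≡ G x xs + F xs) → (∀ x → Monotone (G x)) → Monotone F
  monotone-∷ G F-∷ G-mono [] = ≤-refl
  monotone-∷ {F} G F-∷ G-mono {ys} {x ∷ xs} (_ ∷ʳ ys⊆xs) = begin
    F ys          ≤⟨ monotone-∷ G F-∷ G-mono ys⊆xs ⟩
    F xs          ≤⟨ m≤n+m (F xs) (G x xs) ⟩
    G x xs + F xs ≡⟨ sym (F-∷ x xs) ⟩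
    F (x ∷ xs)    ∎
    where open ≤-Reasoning
  monotone-∷ {F} G F-∷ G-mono {x ∷ ys} {x ∷ xs} (refl ∷ ys⊆xs) = begin
    F (x ∷ ys)    ≡⟨ F-∷ x ys ⟩
    G x ys + F ys ≤⟨ +-mono-≤ (G-mono x ys⊆xs) (monotone-∷ G F-∷ G-mono ys⊆xs) ⟩
    G x xs + F xs ≡⟨ sym (F-∷ x xs) ⟩
    F (x ∷ xs)    ∎
    where open ≤-Reasoning

cube-growth : ∀ k → suc k ^ 3 ≤ k ^ 3 + 3 * suc k ^ 2
cube-growth k = subst (suc k ^ 3 ≤_) (sym (expand k)) (m≤m+n (suc k ^ 3) (3 * k + 2))
  where
  expand : ∀ m → m ^ 3 + 3 * (1 + m) ^ 2 ≡ (1 + m) ^ 3 + (3 * m + 2)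
  expand = solve 1 (λ m → m :^ 3 :+ con 3 :* (con 1 :+ m) :^ 2
                          := (con 1 :+ m) :^ 3 :+ (con 3 :* m :+ con 2)) refl

-- t = 0 forces k = 0, and then 3 s ≤ s contradicts 1 ≤ 2 s.
nonZero-of-deletion : ∀ k t s → k ≤ 2 * t → suc k * t + 3 * s ≤ suc k * s → suc k ≤ 2 * s →
                      NonZero t
nonZero-of-deletion k (suc t) s _ _ _ = _
nonZero-of-deletion zero zero (suc s) _ 3s≤s _ with *-cancelʳ-≤ 3 1 (suc s) 3s≤s
... | s≤s ()

cube-step-from-deletion : ∀ k t s A′ A →
  suc k * t + 3 * s ≤ suc k * s → suc k ≤ 2 * s → k ≤ 2 * t →
  k ^ 3 ≤ 8 * (A′ ^ 2 * t) → A′ ≤ A → suc k ^ 3 ≤ 8 * (A ^ 2 * s)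
cube-step-from-deletion k t s A′ A light n≤2s k≤2t ih A′≤A =
  *-cancelʳ-≤ (suc k ^ 3) (8 * (A ^ 2 * s)) t {{nonZero-of-deletion k t s k≤2t light n≤2s}} (begin
    suc k ^ 3 * t        ≤⟨ +-cancelʳ-≤ (3 * (suc k ^ 2 * s)) _ _ cancelled ⟩
    k ^ 3 * s            ≤⟨ *-monoˡ-≤ s ih ⟩
    8 * (A′ ^ 2 * t) * s ≤⟨ *-monoˡ-≤ s (*-monoʳ-≤ 8 (*-monoˡ-≤ t (^-monoˡ-≤ 2 A′≤A))) ⟩
    8 * (A ^ 2 * t) * s  ≡⟨ swap (A ^ 2) t s ⟩
    8 * (A ^ 2 * s) * t  ∎)
  where
  open ≤-Reasoning
  n = suc k
  cancelled : n ^ 3 * t + 3 * (n ^ 2 * s) ≤ k ^ 3 * s + 3 * (n ^ 2 * s)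
  cancelled = begin
    n ^ 3 * t + 3 * (n ^ 2 * s) ≡⟨ factor n (n ^ 2) t s ⟩
    n ^ 2 * (n * t + 3 * s)     ≤⟨ *-monoʳ-≤ (n ^ 2) light ⟩
    n ^ 2 * (n * s)             ≡⟨ cube n (n ^ 2) s ⟩
    n ^ 3 * s                   ≤⟨ *-monoˡ-≤ s (cube-growth k) ⟩
    (k ^ 3 + 3 * n ^ 2) * s     ≡⟨ distrib (k ^ 3) (n ^ 2) s ⟩
    k ^ 3 * s + 3 * (n ^ 2 * s) ∎
    where
    factor : ∀ n n² t s → n * n² * t + 3 * (n² * s) ≡ n² * (n * t + 3 * s)
    factor = solve-∀
    cube : ∀ n n² s → n² * (n * s) ≡ n * n² * s
    cube = solve-∀
    distrib : ∀ c m s → (c + 3 * m) * s ≡ c * s + 3 * (m * s)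
    distrib = solve-∀
  swap : ∀ a² t s → 8 * (a² * t) * s ≡ 8 * (a² * s) * t
  swap = solve-∀

cube-step-from-arc : ∀ k t A s → suc (2 * t) ≤ k → k ≤ A + t → suc k ≤ 2 * s →
                     suc k ^ 3 ≤ 8 * (A ^ 2 * s)
cube-step-from-arc k t A s 2t<k k≤A+t n≤2s = begin
  suc k ^ 3                   ≡⟨ cube (suc k) ⟩
  suc k * (suc k * suc k)     ≤⟨ *-mono-≤ n≤2A (*-mono-≤ n≤2A n≤2s) ⟩
  2 * A * (2 * A * (2 * s))   ≡⟨ eight A s ⟩
  8 * (A ^ 2 * s)             ∎
  where
  open ≤-Reasoning
  n≤2A : suc k ≤ 2 * A
  n≤2A = +-cancelʳ-≤ k (suc k) (2 * A) (begin
    suc k + k             ≡⟨ double k ⟩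
    suc (2 * k)           ≤⟨ s≤s (*-monoʳ-≤ 2 k≤A+t) ⟩
    suc (2 * (A + t))     ≡⟨ regroup A t ⟩
    2 * A + suc (2 * t)   ≤⟨ +-monoʳ-≤ (2 * A) 2t<k ⟩
    2 * A + k             ∎)
    where
    double : ∀ k → 1 + k + k ≡ 1 + 2 * k
    double = solve-∀
    regroup : ∀ a t → 1 + 2 * (a + t) ≡ 2 * a + (1 + 2 * t)
    regroup = solve-∀
  cube : ∀ n → n ^ 3 ≡ n * (n * n)
  cube = solve 1 (λ n → n :^ 3 := n :* (n :* n)) refl
  eight : ∀ a s → 2 * a * (2 * a * (2 * s)) ≡ 8 * (a ^ 2 * s)
  eight = solve 2 (λ a s → con 2 :* a :* (con 2 :* a :* (con 2 :* s)) := con 8 :* (a :^ 2 :* s)) refl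

module _ (F : FiniteField) where
  open Plane F

  count-++ : ∀ {A : Set} (f : A → Bool) xs ys → count f (xs ++ ys) ≡ count f xs + count f ys
  count-++ f []       ys = refl
  count-++ f (x ∷ xs) ys =
    trans (cong (_ +_) (count-++ f xs ys)) (sym (+-assoc (if f x then 1 else 0) _ _))

  module _ {f : Point × Point × Point → Bool} where

    tripleCount : PointSet → ℕ
    tripleCount L = count f (triples L)

    pairCount : Point → PointSet → ℕ
    pairCount x L = count f (pairsFrom x L)

    apexCount : Point → Point → PointSet → ℕ
    apexCount x y L = count f (map (λ r → x , y , r) L)

    tripleCount-∷ : ∀ x L → tripleCount (x ∷ L) ≡ pairCount x L + tripleCount L
    tripleCount-∷ x L = count-++ f (pairsFrom x L) (triples L)

    pairCount-∷ : ∀ x y L → pairCount x (y ∷ L) ≡ apexCount x y L + pairCount x L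
    pairCount-∷ x y L = count-++ f (map (λ r → x , y , r) L) (pairsFrom x L)

    apexCount-∷ : ∀ x y r L → apexCount x y (r ∷ L) ≡ (if f (x , y , r) then 1 else 0) + apexCount x y L
    apexCount-∷ x y r L = refl

    pairCount-monotone : ∀ x → Monotone (pairCount x)
    pairCount-monotone x =
      monotone-∷ (apexCount x) (pairCount-∷ x) λ y →
      monotone-∷ _ (apexCount-∷ x y) λ r → monotone-const _

    tripleCount-deletionIdentity : DeletionIdentity 3 tripleCount
    tripleCount-deletionIdentity =
      deletionIdentity-∷ {k = 2} pairCount refl tripleCount-∷ λ x →
      deletionIdentity-∷ {k = 1} (apexCount x) refl (pairCount-∷ x) λ y →
      deletionIdentity-∷ {k = 0} _ refl (apexCount-∷ x y) λ r → deletionIdentity-const _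

    -- Greedy: a point is kept iff it closes no triple with the points kept after it.
    ∃-tripleFree-⊆ : ∀ L → ∃ λ R → R ⊆ L × tripleCount R ≡ 0 × length L ≤ length R + tripleCount L
    ∃-tripleFree-⊆ [] = [] , [] , refl , z≤n
    ∃-tripleFree-⊆ (x ∷ L) with ∃-tripleFree-⊆ L
    ... | R , R⊆L , R-free , L≤R+T with pairCount x R in closes
    ...   | zero = x ∷ R , refl ∷ R⊆L , trans (tripleCount-∷ x R) (cong₂ _+_ closes R-free) , (begin
      suc (length L)
        ≤⟨ s≤s L≤R+T ⟩
      suc (length R) + tripleCount L
        ≤⟨ +-monoʳ-≤ (suc (length R)) (m≤n+m (tripleCount L) (pairCount x L)) ⟩
      suc (length R) + (pairCount x L + tripleCount L)
        ≡⟨ cong (suc (length R) +_) (sym (tripleCount-∷ x L)) ⟩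
      suc (length R) + tripleCount (x ∷ L) ∎)
      where open ≤-Reasoning
    ...   | suc _ = R , x ∷ʳ R⊆L , R-free , (begin
      suc (length L)                              ≤⟨ s≤s L≤R+T ⟩
      suc (length R + tripleCount L)              ≡⟨ sym (+-suc (length R) (tripleCount L)) ⟩
      length R + suc (tripleCount L)              ≤⟨ +-monoʳ-≤ (length R) (+-monoˡ-≤ (tripleCount L) x-closes) ⟩
      length R + (pairCount x L + tripleCount L)  ≡⟨ cong (length R +_) (sym (tripleCount-∷ x L)) ⟩
      length R + tripleCount (x ∷ L)              ∎)
      where
      open ≤-Reasoning
      x-closes : 1 ≤ pairCount x L
      x-closes = ≤-trans (subst (1 ≤_) (sym closes) (s≤s z≤n)) (pairCount-monotone x R⊆L)

  T-deletionIdentity : DeletionIdentity 3 T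
  T-deletionIdentity = tripleCount-deletionIdentity

  ∃-arc-⊆ : ∀ L → ∃ λ R → R ⊆ L × T R ≡ 0 × length L ≤ length R + T L
  ∃-arc-⊆ = ∃-tripleFree-⊆

  ⊆⇒∈-subsets : ∀ {A : Set} {R L : List A} → R ⊆ L → R ∈ subsets L
  ⊆⇒∈-subsets []                  = here refl
  ⊆⇒∈-subsets (y ∷ʳ R⊆L)          = ∈-++⁺ˡ (⊆⇒∈-subsets R⊆L)
  ⊆⇒∈-subsets {L = y ∷ L} (refl ∷ R⊆L) = ∈-++⁺ʳ (subsets L) (∈-map⁺ (y ∷_) (⊆⇒∈-subsets R⊆L))

  ∈-subsets⇒⊆ : ∀ {A : Set} {R : List A} L → R ∈ subsets L → R ⊆ L
  ∈-subsets⇒⊆ []      (here refl) = []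
  ∈-subsets⇒⊆ (x ∷ L) R∈ with ∈-++⁻ (subsets L) R∈
  ... | inj₁ R∈′ = x ∷ʳ ∈-subsets⇒⊆ L R∈′
  ... | inj₂ R∈′ with ∈-map⁻ (x ∷_) R∈′
  ...   | R′ , R′∈ , refl = refl ∷ ∈-subsets⇒⊆ L R′∈

  arcSize : PointSet → ℕ
  arcSize Q = if isArc Q then length Q else 0

  maxArcSize : List PointSet → ℕ
  maxArcSize = foldr (λ Q m → arcSize Q ⊔ m) 0

  arcSize≤maxArcSize : ∀ {Q} Qs → Q ∈ Qs → arcSize Q ≤ maxArcSize Qs
  arcSize≤maxArcSize (Q ∷ Qs) (here refl) = m≤m⊔n (arcSize Q) (maxArcSize Qs)
  arcSize≤maxArcSize (Q ∷ Qs) (there Q∈) = ≤-trans (arcSize≤maxArcSize Qs Q∈) (m≤n⊔m (arcSize Q) _)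

  maxArcSize-lub : ∀ Qs {m} → (∀ {Q} → Q ∈ Qs → arcSize Q ≤ m) → maxArcSize Qs ≤ m
  maxArcSize-lub []       _     = z≤n
  maxArcSize-lub (Q ∷ Qs) bound = ⊔-lub (bound (here refl)) (maxArcSize-lub Qs (bound ∘ there))

  arcSize-arc : ∀ Q → T Q ≡ 0 → arcSize Q ≡ length Q
  arcSize-arc Q T≡0 rewrite T≡0 = refl

  arc⇒length≤a : ∀ {Q L} → Q ⊆ L → T Q ≡ 0 → length Q ≤ a L
  arc⇒length≤a {Q} {L} Q⊆L T≡0 =
    subst (_≤ a L) (arcSize-arc Q T≡0) (arcSize≤maxArcSize (subsets L) (⊆⇒∈-subsets Q⊆L))

  a-mono : ∀ {Q L} → Q ⊆ L → a Q ≤ a L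
  a-mono {Q} {L} Q⊆L = maxArcSize-lub (subsets Q) λ R∈ →
    arcSize≤maxArcSize (subsets L) (⊆⇒∈-subsets (⊆-trans (∈-subsets⇒⊆ Q R∈) Q⊆L))

  cube-bound : ∀ n L → length L ≡ n → n ≤ 2 * T L → n ^ 3 ≤ 8 * (a L ^ 2 * T L)
  cube-bound zero    L _ _ = z≤n
  cube-bound (suc k) L |L|≡n n≤2T with ∃-deletion-below-average {k = 3} T-deletionIdentity L |L|≡n
  ... | R , R⊆L , |R|≡k , light with k ≤? 2 * T R
  ...   | yes k≤2t = cube-step-from-deletion k (T R) (T L) (a R) (a L) light n≤2T k≤2t
                       (cube-bound k R |R|≡k k≤2t) (a-mono R⊆L)
  ...   | no  k≰2t with ∃-arc-⊆ R
  ...     | Q , Q⊆R , Q-arc , |R|≤|Q|+t =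
    cube-step-from-arc k (T R) (a L) (T L) (≰⇒> k≰2t) k≤a+t n≤2T
    where
    k≤a+t : k ≤ a L + T R
    k≤a+t = ≤-trans (subst (_≤ length Q + T R) |R|≡k |R|≤|Q|+t)
                    (+-monoˡ-≤ (T R) (arc⇒length≤a (⊆-trans Q⊆R R⊆L) Q-arc))

-- The bound holds for every list of points, distinct or not.
lemma3 : Σ ℕ λ N → NonZero N × ((F : FiniteField) → let open Plane F in
    (P : PointSet) → Distinct P → length P ≤ 2 * T P →
    length P ^ 3 ≤ N * (a P ^ 2 * T P))
lemma3 = 8 , _ , λ F P _ → cube-bound F (length P) P refl
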